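{- Let $G=(V,E)$ be a finite graph with orientation $\varepsilon$. The number of orientations of $G$ that are Eulerian equivalent to $\varepsilon$ equals the number of flows of $(G,\varepsilon)$ with values in $\{0,1\}$: \[ \#[\varepsilon]=\bar\varphi_\varepsilon(G,1)=|\bar\Delta^+_{FL}(G,\varepsilon)\cap\mathbb Z^E|. \]
   Context: Orientations assign directions to edges; $\varepsilon(v,e)=\pm1$ according as $e$ leaves/enters its end-vertex $v$ (loops contribute $0$ in vertex sums). A flow of $(G,\varepsilon)$ is $f:E\to\mathbb R$ with $\sum_e\varepsilon(v,e)f(e)=0$ for all $v$. Two orientations are Eulerian equivalent if the edges on which they differ, oriented by either one, form a directed Eulerian spanning subgraph (in-degree equals out-degree at each vertex); $[\varepsilon]$ is the Eulerian equivalence class of $\varepsilon$ in the set of all orientations. $\bar\varphi_\varepsilon(G,q)=\#\{f \text{ integer flow of }(G,\varepsilon): 0\le f(e)\le q\ \forall e\}$, and $\bar\Delta^+_{FL}(G,\varepsilon)=\{f \text{ real flow of }(G,\varepsilon):0\le f(e)\le1\ \forall e\}$. -}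

module Defs where

open import Data.Bool using (Bool; true; false; if_then_else_)
open import Data.Nat as ℕ using (ℕ; zero; suc)
open import Data.Integer as ℤ using (ℤ; +_; 0ℤ; 1ℤ)
open import Data.Fin as Fin using (Fin; zero; suc)
open import Data.Fin.Properties using () renaming (_≟_ to _≟F_)
open import Data.Product using (_×_; proj₁; proj₂)
open import Data.List using (List; []; _∷_; map; concatMap; length; filter)
open import Relation.Nullary using (Dec; yes; no; ¬_; does)
open import Relation.Unary using (Decidable)
open import Relation.Binary.PropositionalEquality using (_≡_)
open import Relation.Nullary.Decidable using (¬?)
open import Data.Fin.Properties using (all?)

-- Finite graphs (loops and multiple edges allowed)
-- A graph with n vertices and m edges; edge e has ends (ends e).
-- The order of the pair is only a reference labelling of the two ends.

record Graph : Set where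
  constructor graph
  field
    n    : ℕ
    m    : ℕ
    ends : Fin m → Fin n × Fin n

open Graph public

-- An orientation chooses, for each edge, which of its two ends is the tail.
-- true  : edge e directed from proj₁ (ends e) to proj₂ (ends e)
-- false : edge e directed from proj₂ (ends e) to proj₁ (ends e)
-- (a loop therefore also has two orientations).
Orientation : Graph → Set
Orientation G = Fin (m G) → Bool

tail head : (G : Graph) → Orientation G → Fin (m G) → Fin (n G)
tail G ε e = if ε e then proj₁ (ends G e) else proj₂ (ends G e)
head G ε e = if ε e then proj₂ (ends G e) else proj₁ (ends G e)

sumℤ : ∀ {k} → (Fin k → ℤ) → ℤ
sumℤ {zero}  f = 0ℤ
sumℤ {suc k} f = f zero ℤ.+ sumℤ (λ i → f (suc i))

sumℕ : ∀ {k} → (Fin k → ℕ) → ℕ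
sumℕ {zero}  f = 0
sumℕ {suc k} f = f zero ℕ.+ sumℕ (λ i → f (suc i))

indℕ : Bool → ℕ
indℕ true  = 1
indℕ false = 0

-- ε(v,e) : +1 if e leaves v, -1 if e enters v, 0 otherwise; a loop at v
-- contributes +1 - 1 = 0.
inc : (G : Graph) → Orientation G → Fin (n G) → Fin (m G) → ℤ
inc G ε v e = + indℕ (does (tail G ε e ≟F v)) ℤ.- + indℕ (does (head G ε e ≟F v))

IsFlow : (G : Graph) → Orientation G → (Fin (m G) → ℤ) → Set
IsFlow G ε f = ∀ v → sumℤ (λ e → inc G ε v e ℤ.* f e) ≡ 0ℤ

isFlow? : (G : Graph) (ε : Orientation G) (f : Fin (m G) → ℤ) → Dec (IsFlow G ε f)
isFlow? G ε f = all? (λ v → sumℤ (λ e → inc G ε v e ℤ.* f e) ℤ.≟ 0ℤ)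

toℤ : Bool → ℤ
toℤ b = + indℕ b

-- Eulerian equivalence.
-- D = set of edges on which ε and ε' differ; oriented by ε, D must have
-- in-degree = out-degree at every vertex (loops count once in each).

differ : Bool → Bool → Bool
differ true  true  = false
differ false false = false
differ _     _     = true

outdegD indegD : (G : Graph) → Orientation G → Orientation G → Fin (n G) → ℕ
outdegD G ε ε' v =
  sumℕ (λ e → indℕ (differ (ε e) (ε' e)) ℕ.* indℕ (does (tail G ε e ≟F v)))
indegD G ε ε' v =
  sumℕ (λ e → indℕ (differ (ε e) (ε' e)) ℕ.* indℕ (does (head G ε e ≟F v)))

EulerianEquiv : (G : Graph) → Orientation G → Orientation G → Set
EulerianEquiv G ε ε' = ∀ v → indegD G ε ε' v ≡ outdegD G ε ε' v

eulerianEquiv? : (G : Graph) (ε ε' : Orientation G) → Dec (EulerianEquiv G ε ε')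
eulerianEquiv? G ε ε' = all? (λ v → indegD G ε ε' v ℕ.≟ outdegD G ε ε' v)

allMaps : (k : ℕ) → List (Fin k → Bool)
allMaps zero    = (λ ()) ∷ []
allMaps (suc k) = concatMap (λ g → cons true g ∷ cons false g ∷ []) (allMaps k)
  where
  cons : Bool → (Fin k → Bool) → Fin (suc k) → Bool
  cons b g zero    = b
  cons b g (suc i) = g i

countMaps : (k : ℕ) {P : (Fin k → Bool) → Set} → Decidable P → ℕ
countMaps k P? = length (filter P? (allMaps k))

#class : (G : Graph) → Orientation G → ℕ
#class G ε = countMaps (m G) (eulerianEquiv? G ε)

-- φ̄_ε(G,1) : number of integer flows f with 0 ≤ f(e) ≤ 1, i.e. {0,1}-valued flows
φ̄₁ : (G : Graph) → Orientation G → ℕ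
φ̄₁ G ε = countMaps (m G) (λ f → isFlow? G ε (λ e → toℤ (f e)))

-- Identify an orientation ε' with the {0,1}-function f = ε ⊕ ε' on edges
-- (f(e) = 1 iff ε and ε' differ at e).  Two facts give the result.
--
-- Pointwise exclusive-or with a fixed h is a bijection of the
--    maps Fin k → Bool.  Hence if P g ⇔ Q (h ⊕ g) for every g, then P and Q
--    hold for equally many maps (countMaps-xor).  This is proved by induction
--    on k, following the recursive enumeration allMaps: the maps on Fin (suc k)
--    are the two extensions of each map on Fin k, and xor with h either keeps
--    the two halves (h 0 = false) or swaps them (h 0 = true).
--
-- For f = ε ⊕ ε', the net ε-outflow of f at a vertex v equals
--    outdeg_D(v) − indeg_D(v), where D is the set of edges where ε and ε'
--    differ, oriented by ε (netFlow-difference).  So f is a flow exactly when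
--    ε' is Eulerian equivalent to ε (eulerian⇔flow).
module Submission where

open import Data.Bool using (Bool; true; false)
open import Data.Nat as ℕ using (ℕ; zero; suc)
open import Data.Nat.Properties using (+-comm)
import Data.Nat.Tactic.RingSolver as ℕ-Solver
open import Data.Integer as ℤ using (ℤ; +_)
open import Data.Integer.Properties using (pos-*; +-injective; i≡j⇒i-j≡0; i-j≡0⇒i≡j)
import Data.Integer.Tactic.RingSolver as ℤ-Solver
open import Data.Fin using (Fin; zero; suc)
open import Data.Fin.Properties using () renaming (_≟_ to _≟F_)
open import Data.List using (List; []; _∷_; length; filter; concatMap)
open import Data.Product using (_×_; _,_; proj₁; proj₂)
open import Data.Empty using (⊥-elim)
open import Relation.Nullary using (yes; no; does)
open import Relation.Unary using (Decidable)
open import Relation.Binary.PropositionalEquality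
  using (_≡_; refl; sym; trans; cong; cong₂; module ≡-Reasoning)
open import Defs

count : {A : Set} {P : A → Set} → Decidable P → List A → ℕ
count P? xs = length (filter P? xs)

count-∷ : {A : Set} {P : A → Set} (P? : Decidable P) (x : A) (xs : List A) →
          count P? (x ∷ xs) ≡ indℕ (does (P? x)) ℕ.+ count P? xs
count-∷ P? x xs with does (P? x)
... | true  = refl
... | false = refl

count-singleton : {A B : Set} {P : A → Set} {Q : B → Set}
                  (P? : Decidable P) (Q? : Decidable Q) (x : A) (y : B) →
                  (P x → Q y) → (Q y → P x) → count P? (x ∷ []) ≡ count Q? (y ∷ [])
count-singleton P? Q? x y to from with P? x | Q? y
... | yes _  | yes _  = refl
... | no _   | no _   = refl
... | yes px | no ¬qy = ⊥-elim (¬qy (to px))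
... | no ¬px | yes qy = ⊥-elim (¬px (from qy))

count-pairs : {A B : Set} {P : A → Set} (P? : Decidable P) (c₁ c₂ : B → A) (xs : List B) →
              count P? (concatMap (λ a → c₁ a ∷ c₂ a ∷ []) xs)
              ≡ count (λ a → P? (c₁ a)) xs ℕ.+ count (λ a → P? (c₂ a)) xs
count-pairs P? c₁ c₂ []       = refl
count-pairs {A} P? c₁ c₂ (x ∷ xs) = begin
  count P? (c₁ x ∷ c₂ x ∷ rest)
    ≡⟨ count-∷ P? (c₁ x) _ ⟩
  i₁ ℕ.+ count P? (c₂ x ∷ rest)
    ≡⟨ cong (i₁ ℕ.+_) (count-∷ P? (c₂ x) _) ⟩
  i₁ ℕ.+ (i₂ ℕ.+ count P? rest)
    ≡⟨ cong (λ r → i₁ ℕ.+ (i₂ ℕ.+ r)) (count-pairs P? c₁ c₂ xs) ⟩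
  i₁ ℕ.+ (i₂ ℕ.+ (n₁ ℕ.+ n₂))
    ≡⟨ interchange i₁ i₂ n₁ n₂ ⟩
  (i₁ ℕ.+ n₁) ℕ.+ (i₂ ℕ.+ n₂)
    ≡⟨ sym (cong₂ ℕ._+_ (count-∷ (λ a → P? (c₁ a)) x xs) (count-∷ (λ a → P? (c₂ a)) x xs)) ⟩
  count (λ a → P? (c₁ a)) (x ∷ xs) ℕ.+ count (λ a → P? (c₂ a)) (x ∷ xs) ∎
  where
  open ≡-Reasoning
  rest : List A
  rest = concatMap (λ a → c₁ a ∷ c₂ a ∷ []) xs
  i₁ i₂ n₁ n₂ : ℕ
  i₁ = indℕ (does (P? (c₁ x)))
  i₂ = indℕ (does (P? (c₂ x)))
  n₁ = count (λ a → P? (c₁ a)) xs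
  n₂ = count (λ a → P? (c₂ a)) xs
  interchange : ∀ a b p q → a ℕ.+ (b ℕ.+ (p ℕ.+ q)) ≡ (a ℕ.+ p) ℕ.+ (b ℕ.+ q)
  interchange = ℕ-Solver.solve-∀

Extends : {k : ℕ} → Bool → ((Fin k → Bool) → Fin (suc k) → Bool) → Set
Extends b c = ∀ g → c g zero ≡ b × (∀ i → c g (suc i) ≡ g i)

-- The two extension maps are local to the definition of allMaps; this record
-- names them together with the facts the counting argument needs.
record Extensions (k : ℕ) : Set where
  field
    ext₁ ext₀   : (Fin k → Bool) → Fin (suc k) → Bool
    allMaps-suc : allMaps (suc k) ≡ concatMap (λ g → ext₁ g ∷ ext₀ g ∷ []) (allMaps k)
    ext₁-extends : Extends true ext₁
    ext₀-extends : Extends false ext₀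

extensions : (k : ℕ) → Extensions k
extensions k = record
  { allMaps-suc  = refl
  ; ext₁-extends = λ g → refl , λ i → refl
  ; ext₀-extends = λ g → refl , λ i → refl
  }

IsXor : {k : ℕ} → (h g f : Fin k → Bool) → Set
IsXor h g f = ∀ i → f i ≡ differ (h i) (g i)

XorInvariant : {k : ℕ} → (Fin k → Bool) → ((Fin k → Bool) → Set) → ((Fin k → Bool) → Set) → Set
XorInvariant h P Q = ∀ g f → IsXor h g f → (P g → Q f) × (Q f → P g)

xorInvariant-restrict :
  {k : ℕ} {h : Fin (suc k) → Bool} {P Q : (Fin (suc k) → Bool) → Set} →
  XorInvariant h P Q →
  {b : Bool} {c d : (Fin k → Bool) → Fin (suc k) → Bool} →
  Extends b c → Extends (differ (h zero) b) d →
  XorInvariant (λ i → h (suc i)) (λ g → P (c g)) (λ f → Q (d f))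
xorInvariant-restrict {h = h} inv {c = c} {d} c-ext d-ext g f g⊕f =
  inv (c g) (d f) extended
  where
  extended : IsXor h (c g) (d f)
  extended zero =
    trans (proj₁ (d-ext f)) (cong (differ (h zero)) (sym (proj₁ (c-ext g))))
  extended (suc i) =
    trans (proj₂ (d-ext f) i) (trans (g⊕f i) (cong (differ (h (suc i))) (sym (proj₂ (c-ext g) i))))

module Halves (k : ℕ) where
  open Extensions (extensions k)

  extension : Bool → (Fin k → Bool) → Fin (suc k) → Bool
  extension true  = ext₁
  extension false = ext₀

  extension-extends : (b : Bool) → Extends b (extension b)
  extension-extends true  = ext₁-extends
  extension-extends false = ext₀-extends

  half : {R : (Fin (suc k) → Bool) → Set} → Decidable R → Bool → ℕ
  half R? b = countMaps k (λ g → R? (extension b g))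

  countMaps-suc : {R : (Fin (suc k) → Bool) → Set} (R? : Decidable R) →
                  countMaps (suc k) R? ≡ half R? true ℕ.+ half R? false
  countMaps-suc R? = trans (cong (count R?) allMaps-suc) (count-pairs R? ext₁ ext₀ (allMaps k))

  halves-xor : {R : (Fin (suc k) → Bool) → Set} (R? : Decidable R) (a : Bool) →
               half R? (differ a true) ℕ.+ half R? (differ a false) ≡ half R? true ℕ.+ half R? false
  halves-xor R? false = refl
  halves-xor R? true  = +-comm (half R? false) (half R? true)

-- Xor with h is a bijection of the maps Fin k → Bool, so predicates it
-- exchanges hold for equally many maps.
countMaps-xor : (k : ℕ) (h : Fin k → Bool) {P Q : (Fin k → Bool) → Set}
                (P? : Decidable P) (Q? : Decidable Q) →
                XorInvariant h P Q → countMaps k P? ≡ countMaps k Q?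
countMaps-xor zero h P? Q? inv =
  count-singleton P? Q? _ _ (proj₁ (inv _ _ λ ())) (proj₂ (inv _ _ λ ()))
countMaps-xor (suc k) h P? Q? inv = begin
  countMaps (suc k) P?
    ≡⟨ countMaps-suc P? ⟩
  half P? true ℕ.+ half P? false
    ≡⟨ cong₂ ℕ._+_ (matched true) (matched false) ⟩
  half Q? (differ (h zero) true) ℕ.+ half Q? (differ (h zero) false)
    ≡⟨ halves-xor Q? (h zero) ⟩
  half Q? true ℕ.+ half Q? false
    ≡⟨ sym (countMaps-suc Q?) ⟩
  countMaps (suc k) Q? ∎
  where
  open ≡-Reasoning
  open Halves k
  matched : (b : Bool) → half P? b ≡ half Q? (differ (h zero) b)
  matched b = countMaps-xor k (λ i → h (suc i)) _ _
    (xorInvariant-restrict inv (extension-extends b) (extension-extends (differ (h zero) b)))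

sumℤ-cong : {k : ℕ} {f g : Fin k → ℤ} → (∀ i → f i ≡ g i) → sumℤ f ≡ sumℤ g
sumℤ-cong {zero}  f≗g = refl
sumℤ-cong {suc k} f≗g = cong₂ ℤ._+_ (f≗g zero) (sumℤ-cong (λ i → f≗g (suc i)))

sumℤ-difference : {k : ℕ} (a b : Fin k → ℕ) →
                  sumℤ (λ e → + a e ℤ.- + b e) ≡ + sumℕ a ℤ.- + sumℕ b
sumℤ-difference {zero}  a b = refl
sumℤ-difference {suc k} a b = begin
  (+ a zero ℤ.- + b zero) ℤ.+ sumℤ (λ e → + a (suc e) ℤ.- + b (suc e))
    ≡⟨ cong (λ s → (+ a zero ℤ.- + b zero) ℤ.+ s) (sumℤ-difference (λ e → a (suc e)) (λ e → b (suc e))) ⟩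
  (+ a zero ℤ.- + b zero) ℤ.+ (+ sumℕ (λ e → a (suc e)) ℤ.- + sumℕ (λ e → b (suc e)))
    ≡⟨ regroup (+ a zero) (+ b zero) (+ sumℕ (λ e → a (suc e))) (+ sumℕ (λ e → b (suc e))) ⟩
  (+ a zero ℤ.+ + sumℕ (λ e → a (suc e))) ℤ.- (+ b zero ℤ.+ + sumℕ (λ e → b (suc e))) ∎
  where
  open ≡-Reasoning
  regroup : ∀ x y s t → (x ℤ.- y) ℤ.+ (s ℤ.- t) ≡ (x ℤ.+ s) ℤ.- (y ℤ.+ t)
  regroup = ℤ-Solver.solve-∀

scale-difference : (a b c : ℕ) → (+ a ℤ.- + b) ℤ.* + c ≡ + (c ℕ.* a) ℤ.- + (c ℕ.* b)
scale-difference a b c = begin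
  (+ a ℤ.- + b) ℤ.* + c         ≡⟨ distrib (+ a) (+ b) (+ c) ⟩
  + c ℤ.* + a ℤ.- + c ℤ.* + b   ≡⟨ sym (cong₂ ℤ._-_ (pos-* c a) (pos-* c b)) ⟩
  + (c ℕ.* a) ℤ.- + (c ℕ.* b)   ∎
  where
  open ≡-Reasoning
  distrib : ∀ x y z → (x ℤ.- y) ℤ.* z ≡ z ℤ.* x ℤ.- z ℤ.* y
  distrib = ℤ-Solver.solve-∀

module _ (G : Graph) (ε : Orientation G) where

  netFlow-difference : (ε' f : Orientation G) → IsXor ε ε' f → (v : Fin (n G)) →
    sumℤ (λ e → inc G ε v e ℤ.* toℤ (f e)) ≡ + outdegD G ε ε' v ℤ.- + indegD G ε ε' v
  netFlow-difference ε' f ε⊕ε' v =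
    trans (sumℤ-cong termwise)
          (sumℤ-difference (λ e → inDiff e ℕ.* isTail e) (λ e → inDiff e ℕ.* isHead e))
    where
    inDiff : Fin (m G) → ℕ
    inDiff e = indℕ (differ (ε e) (ε' e))
    isTail isHead : Fin (m G) → ℕ
    isTail e = indℕ (does (tail G ε e ≟F v))
    isHead e = indℕ (does (head G ε e ≟F v))
    termwise : ∀ e → inc G ε v e ℤ.* toℤ (f e)
                     ≡ + (inDiff e ℕ.* isTail e) ℤ.- + (inDiff e ℕ.* isHead e)
    termwise e = trans (cong (λ x → inc G ε v e ℤ.* toℤ x) (ε⊕ε' e))
                       (scale-difference (isTail e) (isHead e) (inDiff e))

  eulerian⇔flow : XorInvariant ε (EulerianEquiv G ε) (λ f → IsFlow G ε (λ e → toℤ (f e)))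
  eulerian⇔flow ε' f ε⊕ε' = eulerian⇒flow , flow⇒eulerian
    where
    eulerian⇒flow : EulerianEquiv G ε ε' → IsFlow G ε (λ e → toℤ (f e))
    eulerian⇒flow in≡out v =
      trans (netFlow-difference ε' f ε⊕ε' v) (i≡j⇒i-j≡0 (cong +_ (sym (in≡out v))))
    flow⇒eulerian : IsFlow G ε (λ e → toℤ (f e)) → EulerianEquiv G ε ε'
    flow⇒eulerian flow v = sym (+-injective
      (i-j≡0⇒i≡j _ _ (trans (sym (netFlow-difference ε' f ε⊕ε' v)) (flow v))))

proposition5p5 : (G : Graph) (ε : Orientation G) → #class G ε ≡ φ̄₁ G ε
proposition5p5 G ε =
  countMaps-xor (m G) ε (eulerianEquiv? G ε) (λ f → isFlow? G ε (λ e → toℤ (f e)))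
    (eulerian⇔flow G ε)
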